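{- For every prime $p$, every integer $m$, and all integers $k\ge 0$, $\ell\ge 0$, $s\ge 1$, $$\binom{mp^s-\ell}{kp^s}\equiv\binom{mp^{s-1}-\lceil \ell/p\rceil}{kp^{s-1}}\pmod{p^s}.$$
   Context: For an integer $N$ (possibly negative) and integer $j\ge0$, $\binom{N}{j}=N(N-1)\cdots(N-j+1)/j!$. $\lceil\cdot\rceil$ is the ceiling function. -}

module Defs where

open import Data.Nat as ℕ using (ℕ; zero; suc; NonZero; _∸_)
open import Data.Nat using (_!)
open import Data.Nat.Properties using (_!≢0)
open import Data.Integer as ℤ using (ℤ; +_; _-_; _*_)
open import Data.Integer.Divisibility using (_∣_)

falling : ℤ → ℕ → ℤ
falling N zero    = + 1
falling N (suc j) = falling N j * (N - + j)

-- generalized binomial coefficient  binom N j = N(N-1)...(N-j+1)/j!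
-- for N ∈ ℤ, j ∈ ℕ  (the division is exact; we use integer division by j! ≠ 0)
binom : ℤ → ℕ → ℤ
binom N j = ℤ._/_ (falling N j) (+ (j !)) {{j !≢0}}

ceilDiv : ℕ → (d : ℕ) → .{{NonZero d}} → ℕ
ceilDiv ℓ d = ℕ._/_ (ℓ ℕ.+ (d ∸ 1)) d

_≡_[mod_] : ℤ → ℤ → ℕ → Set
a ≡ b [mod n ] = + n ∣ (a - b)

-- Write m p^s − ℓ = p M + r with M = m p^(s−1) − ⌈ℓ/p⌉ and 0 ≤ r < p. Since p^s divides the lower
-- index j = k p^s, Pascal's rule and absorption, (N + 1) C(N, j − 1) = j C(N + 1, j), give
-- C(N + 1, j) ≡ C(N, j) mod p^s whenever p ∤ N + 1; stepping from p M up to p M + r removes r.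
-- For C(p M, p J) with J = k p^(s−1): in both (p J)! and the numerator of C(p M, p J) the multiples
-- of p contribute p^J J! resp. p^J J! C(M, J), so C(p M, p J) U(0) = C(M, J) U(M − J), where U(X) is
-- the product of the remaining factors, all prime to p. U(X) is a product of J consecutive terms of
-- a sequence that is p^(s−1)-periodic modulo p^s, so U(M − J) ≡ U(0), and this unit cancels.

module Submission where

open import Defs
open import Data.Nat using (ℕ; suc; _^_; _≥_)
open import Data.Nat.Primality using (Prime; prime⇒nonZero)
open import Data.Integer using (ℤ; +_; _-_; _*_)

open import Level using (0ℓ)
open import Data.Nat as ℕ using (zero; NonZero; _!; _∸_; z≤n; s≤s)
open import Data.Nat.Properties as ℕ using (_!≢0)
open import Data.Nat.Divisibility as ℕ using (_∤_)
import Data.Nat.DivMod as ℕ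
open import Data.Nat.Primality using (euclidsLemma; prime⇒nonTrivial)
import Data.Nat.Tactic.RingSolver as ℕ-Solver
open import Data.Integer as ℤ using (-[1+_]; 0ℤ; 1ℤ; _+_; -_; ∣_∣) renaming (suc to sucℤ)
import Data.Integer.Properties as ℤ
import Data.Integer.DivMod as ℤ
open import Data.Integer.Divisibility.Signed as Signed using (divides)
open import Data.Integer.Tactic.RingSolver using (solve-∀)
open import Data.Product using (∃-syntax; _×_; _,_)
open import Data.Sum using (inj₁; inj₂)
open import Relation.Binary.Bundles using (Setoid)
import Relation.Binary.Reasoning.Setoid as SetoidReasoning
open import Relation.Binary.PropositionalEquality using (_≡_; refl; sym; trans; cong; cong₂; subst; subst₂; module ≡-Reasoning)
open import Relation.Nullary using (contradiction)

ℤ-induction : ∀ {ℓ} (P : ℤ → Set ℓ) → P 0ℤ →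
              (∀ i → P i → P (1ℤ + i)) → (∀ i → P (1ℤ + i) → P i) → ∀ i → P i
ℤ-induction P P0 up down (+ zero)     = P0
ℤ-induction P P0 up down (+ suc n)    = up (+ n) (ℤ-induction P P0 up down (+ n))
ℤ-induction P P0 up down -[1+ zero ]  = down -[1+ 0 ] P0
ℤ-induction P P0 up down -[1+ suc n ] = down -[1+ suc n ] (ℤ-induction P P0 up down -[1+ n ])

[1+i]+j≡i+[1+j] : ∀ i j → (1ℤ + i) + j ≡ i + (1ℤ + j)
[1+i]+j≡i+[1+j] = solve-∀

∏ : (ℤ → ℤ) → ℤ → ℕ → ℤ
∏ f A zero    = 1ℤ
∏ f A (suc n) = f A * ∏ f (1ℤ + A) n

∏-suc : ∀ f A n → ∏ f A (suc n) ≡ ∏ f A n * f (A + + n)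
∏-suc f A zero    = begin
  f A * 1ℤ        ≡⟨ ℤ.*-identityʳ (f A) ⟩
  f A             ≡⟨ cong f (ℤ.+-identityʳ A) ⟨
  f (A + 0ℤ)      ≡⟨ ℤ.*-identityˡ (f (A + 0ℤ)) ⟨
  1ℤ * f (A + 0ℤ) ∎
  where open ≡-Reasoning
∏-suc f A (suc n) = begin
  f A * ∏ f (1ℤ + A) (suc n)                  ≡⟨ cong (f A *_) (∏-suc f (1ℤ + A) n) ⟩
  f A * (∏ f (1ℤ + A) n * f ((1ℤ + A) + + n)) ≡⟨ ℤ.*-assoc (f A) _ _ ⟨
  f A * ∏ f (1ℤ + A) n * f ((1ℤ + A) + + n)   ≡⟨ cong (λ B → f A * ∏ f (1ℤ + A) n * f B) ([1+i]+j≡i+[1+j] A (+ n)) ⟩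
  f A * ∏ f (1ℤ + A) n * f (A + + suc n)      ∎
  where open ≡-Reasoning

∏-+ : ∀ f A m n → ∏ f A (m ℕ.+ n) ≡ ∏ f A m * ∏ f (A + + m) n
∏-+ f A zero    n = begin
  ∏ f A n             ≡⟨ cong (λ B → ∏ f B n) (ℤ.+-identityʳ A) ⟨
  ∏ f (A + 0ℤ) n      ≡⟨ ℤ.*-identityˡ _ ⟨
  1ℤ * ∏ f (A + 0ℤ) n ∎
  where open ≡-Reasoning
∏-+ f A (suc m) n = begin
  f A * ∏ f (1ℤ + A) (m ℕ.+ n)                    ≡⟨ cong (f A *_) (∏-+ f (1ℤ + A) m n) ⟩
  f A * (∏ f (1ℤ + A) m * ∏ f ((1ℤ + A) + + m) n) ≡⟨ ℤ.*-assoc (f A) _ _ ⟨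
  f A * ∏ f (1ℤ + A) m * ∏ f ((1ℤ + A) + + m) n   ≡⟨ cong (λ B → f A * ∏ f (1ℤ + A) m * ∏ f B n) ([1+i]+j≡i+[1+j] A (+ m)) ⟩
  f A * ∏ f (1ℤ + A) m * ∏ f (A + + suc m) n      ∎
  where open ≡-Reasoning

rising : ℤ → ℕ → ℤ
rising = ∏ sucℤ

rising-0 : ∀ n → rising 0ℤ n ≡ + (n !)
rising-0 zero    = refl
rising-0 (suc n) = begin
  rising 0ℤ (suc n)     ≡⟨ ∏-suc sucℤ 0ℤ n ⟩
  rising 0ℤ n * + suc n ≡⟨ cong (_* + suc n) (rising-0 n) ⟩
  + (n !) * + suc n     ≡⟨ ℤ.*-comm (+ (n !)) (+ suc n) ⟩
  + suc n * + (n !)     ≡⟨ ℤ.pos-* (suc n) (n !) ⟨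
  + (suc n !)           ∎
  where open ≡-Reasoning

rising-pascal : ∀ A n → rising (1ℤ + A) (suc n) ≡ rising A (suc n) + + suc n * rising (1ℤ + A) n
rising-pascal A n = begin
  rising (1ℤ + A) (suc n)                                    ≡⟨ ∏-suc sucℤ (1ℤ + A) n ⟩
  rising (1ℤ + A) n * (1ℤ + ((1ℤ + A) + + n))                ≡⟨ expand A (+ n) (rising (1ℤ + A) n) ⟩
  (1ℤ + A) * rising (1ℤ + A) n + + suc n * rising (1ℤ + A) n ∎
  where
  open ≡-Reasoning
  expand : ∀ A n R → R * (1ℤ + ((1ℤ + A) + n)) ≡ (1ℤ + A) * R + (1ℤ + n) * R
  expand = solve-∀

1+[N-[1+j]]≡N-j : ∀ N j → 1ℤ + (N - (1ℤ + j)) ≡ N - j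
1+[N-[1+j]]≡N-j = solve-∀

falling≡rising : ∀ N j → falling N j ≡ rising (N - + j) j
falling≡rising N zero    = refl
falling≡rising N (suc j) = begin
  falling N j * (N - + j)                              ≡⟨ cong (_* (N - + j)) (falling≡rising N j) ⟩
  rising (N - + j) j * (N - + j)                       ≡⟨ ℤ.*-comm (rising (N - + j) j) (N - + j) ⟩
  (N - + j) * rising (N - + j) j                       ≡⟨ cong (λ B → B * rising B j) (1+[N-[1+j]]≡N-j N (+ j)) ⟨
  (1ℤ + (N - + suc j)) * rising (1ℤ + (N - + suc j)) j ∎
  where open ≡-Reasoning

-- Induction on A over ℤ: by rising-pascal, a unit step of A changes rising A (suc n) by a multiple of (suc n)!.
!∣rising : ∀ n A → + (n !) Signed.∣ rising A n
!∣rising zero    A = Signed.∣-reflexive (sym (ℤ.*-identityʳ _))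
!∣rising (suc n) = ℤ-induction P base up down
  where
  P : ℤ → Set
  P A = + (suc n !) Signed.∣ rising A (suc n)
  base : P 0ℤ
  base = Signed.∣-reflexive (sym (rising-0 (suc n)))
  !∣increment : ∀ A → + (suc n !) Signed.∣ + suc n * rising (1ℤ + A) n
  !∣increment A = subst (Signed._∣ (+ suc n * rising (1ℤ + A) n)) (sym (ℤ.pos-* (suc n) (n !)))
                    (Signed.*-monoʳ-∣ (+ suc n) (!∣rising n (1ℤ + A)))
  up : ∀ A → P A → P (1ℤ + A)
  up A PA = subst (Signed._∣_ _) (sym (rising-pascal A n)) (Signed.∣m∣n⇒∣m+n PA (!∣increment A))
  down : ∀ A → P (1ℤ + A) → P A
  down A PA = Signed.∣m+n∣n⇒∣m (subst (Signed._∣_ _) (rising-pascal A n) PA) (!∣increment A)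

i*n/n≡i : ∀ i n .{{_ : NonZero n}} → (i * + n) ℤ./ + n ≡ i
i*n/n≡i i n = sym (ℤ.i-j≡0⇒i≡j i Q (ℤ.∣i∣≡0⇒i≡0 (ℕ.n<1⇒n≡0 (ℕ.*-cancelʳ-< n _ 1 ∣i-Q∣*n<1*n))))
  where
  Q = (i * + n) ℤ./ + n
  r = (i * + n) ℤ.% + n
  remainder : + r ≡ (i - Q) * + n
  remainder = begin
    + r                     ≡⟨ add-sub (+ r) (Q * + n) ⟩
    + r + Q * + n - Q * + n ≡⟨ cong (_- Q * + n) (ℤ.a≡a%n+[a/n]*n (i * + n) (+ n)) ⟨
    i * + n - Q * + n       ≡⟨ sub-distrib i Q (+ n) ⟩
    (i - Q) * + n           ∎
    where
    open ≡-Reasoning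
    add-sub : ∀ a b → a ≡ a + b - b
    add-sub = solve-∀
    sub-distrib : ∀ i Q n → i * n - Q * n ≡ (i - Q) * n
    sub-distrib = solve-∀
  ∣i-Q∣*n<1*n : ∣ i - Q ∣ ℕ.* n ℕ.< 1 ℕ.* n
  ∣i-Q∣*n<1*n = subst₂ ℕ._<_ (trans (cong ∣_∣ remainder) (ℤ.abs-* (i - Q) (+ n))) (sym (ℕ.*-identityˡ n))
                  (ℤ.n%d<d (i * + n) (+ n))

binom*!≡rising : ∀ N j → binom N j * + (j !) ≡ rising (N - + j) j
binom*!≡rising N j with !∣rising j (N - + j)
... | divides w rising≡w*j! = begin
  binom N j * + (j !)                               ≡⟨ cong (λ x → ℤ._/_ x (+ (j !)) {{j !≢0}} * + (j !))
                                                          (trans (falling≡rising N j) rising≡w*j!) ⟩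
  ℤ._/_ (w * + (j !)) (+ (j !)) {{j !≢0}} * + (j !) ≡⟨ cong (_* + (j !)) (i*n/n≡i w (j !) {{j !≢0}}) ⟩
  w * + (j !)                                       ≡⟨ rising≡w*j! ⟨
  rising (N - + j) j                                ∎
  where open ≡-Reasoning

binom-pascal : ∀ N j → binom (1ℤ + N) (suc j) ≡ binom N (suc j) + binom N j
binom-pascal N j = ℤ.*-cancelʳ-≡ _ _ (+ (suc j !)) {{suc j !≢0}} (begin
  binom (1ℤ + N) (suc j) * + (suc j !)                ≡⟨ binom*!≡rising (1ℤ + N) (suc j) ⟩
  rising ((1ℤ + N) - + suc j) (suc j)                 ≡⟨ cong (λ B → rising B (suc j)) ([1+i]-j≡1+[i-j] N (+ suc j)) ⟩
  rising (1ℤ + A) (suc j)                             ≡⟨ rising-pascal A j ⟩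
  rising A (suc j) + + suc j * rising (1ℤ + A) j      ≡⟨ cong₂ (λ x y → x + + suc j * y) (binom*!≡rising N (suc j)) b₀*j!≡rising ⟨
  b₁ * + (suc j !) + + suc j * (b₀ * + (j !))         ≡⟨ cong (λ x → b₁ * x + + suc j * (b₀ * + (j !))) (ℤ.pos-* (suc j) (j !)) ⟩
  b₁ * (+ suc j * + (j !)) + + suc j * (b₀ * + (j !)) ≡⟨ collect b₁ b₀ (+ suc j) (+ (j !)) ⟩
  (b₁ + b₀) * (+ suc j * + (j !))                     ≡⟨ cong ((b₁ + b₀) *_) (ℤ.pos-* (suc j) (j !)) ⟨
  (b₁ + b₀) * + (suc j !)                             ∎)
  where
  open ≡-Reasoning
  A  = N - + suc j
  b₁ = binom N (suc j)
  b₀ = binom N j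
  [1+i]-j≡1+[i-j] : ∀ i j → (1ℤ + i) - j ≡ 1ℤ + (i - j)
  [1+i]-j≡1+[i-j] = solve-∀
  b₀*j!≡rising : b₀ * + (j !) ≡ rising (1ℤ + A) j
  b₀*j!≡rising = trans (binom*!≡rising N j) (cong (λ B → rising B j) (sym (1+[N-[1+j]]≡N-j N (+ j))))
  collect : ∀ a b s f → a * (s * f) + s * (b * f) ≡ (a + b) * (s * f)
  collect = solve-∀

binom-absorption : ∀ N j → (1ℤ + N) * binom N j ≡ + suc j * binom (1ℤ + N) (suc j)
binom-absorption N j = ℤ.*-cancelʳ-≡ _ _ (+ (j !)) {{j !≢0}} (begin
  (1ℤ + N) * binom N j * + (j !)              ≡⟨ ℤ.*-assoc (1ℤ + N) _ _ ⟩
  (1ℤ + N) * (binom N j * + (j !))            ≡⟨ cong ((1ℤ + N) *_) (binom*!≡rising N j) ⟩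
  (1ℤ + N) * rising (N - + j) j               ≡⟨ ℤ.*-comm (1ℤ + N) _ ⟩
  rising (N - + j) j * (1ℤ + N)               ≡⟨ cong (rising (N - + j) j *_) (1+[N-j+j]≡1+N N (+ j)) ⟨
  rising (N - + j) j * (1ℤ + (N - + j + + j)) ≡⟨ ∏-suc sucℤ (N - + j) j ⟨
  rising (N - + j) (suc j)                    ≡⟨ cong (λ B → rising B (suc j)) ([1+N]-[1+j]≡N-j N (+ j)) ⟨
  rising ((1ℤ + N) - + suc j) (suc j)         ≡⟨ binom*!≡rising (1ℤ + N) (suc j) ⟨
  b₁ * + (suc j !)                            ≡⟨ cong (b₁ *_) (ℤ.pos-* (suc j) (j !)) ⟩
  b₁ * (+ suc j * + (j !))                    ≡⟨ swap b₁ (+ suc j) (+ (j !)) ⟩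
  + suc j * b₁ * + (j !)                      ∎)
  where
  open ≡-Reasoning
  b₁ = binom (1ℤ + N) (suc j)
  1+[N-j+j]≡1+N : ∀ N j → 1ℤ + (N - j + j) ≡ 1ℤ + N
  1+[N-j+j]≡1+N = solve-∀
  [1+N]-[1+j]≡N-j : ∀ N j → (1ℤ + N) - (1ℤ + j) ≡ N - j
  [1+N]-[1+j]≡N-j = solve-∀
  swap : ∀ b s f → b * (s * f) ≡ s * b * f
  swap = solve-∀

-- _≡_[mod_] wrapped in a record, so that the two sides of a congruence can be inferred from its type.
record _≡_⟨mod_⟩ (a b : ℤ) (n : ℕ) : Set where
  constructor ⟨_⟩
  field
    ≡-mod : a ≡ b [mod n ]

open _≡_⟨mod_⟩ public

infix 4 _≡_⟨mod_⟩

module _ {n : ℕ} where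

  ∣-⇒≡⟨mod⟩ : ∀ {a b} → + n Signed.∣ a - b → a ≡ b ⟨mod n ⟩
  ∣-⇒≡⟨mod⟩ n∣a-b = ⟨ Signed.∣⇒∣ᵤ n∣a-b ⟩

  ≡⟨mod⟩⇒∣- : ∀ {a b} → a ≡ b ⟨mod n ⟩ → + n Signed.∣ a - b
  ≡⟨mod⟩⇒∣- ⟨ n∣a-b ⟩ = Signed.∣ᵤ⇒∣ n∣a-b

  ≡⇒≡⟨mod⟩ : ∀ {a b} → a ≡ b → a ≡ b ⟨mod n ⟩
  ≡⇒≡⟨mod⟩ {a} refl = ∣-⇒≡⟨mod⟩ (divides 0ℤ (ℤ.+-inverseʳ a))

  ≡⟨mod⟩-sym : ∀ {a b} → a ≡ b ⟨mod n ⟩ → b ≡ a ⟨mod n ⟩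
  ≡⟨mod⟩-sym {a} {b} a≡b = ∣-⇒≡⟨mod⟩ (subst (+ n Signed.∣_) (negate-sub a b) (Signed.∣m⇒∣-m (≡⟨mod⟩⇒∣- a≡b)))
    where
    negate-sub : ∀ a b → - (a - b) ≡ b - a
    negate-sub = solve-∀

  ≡⟨mod⟩-trans : ∀ {a b c} → a ≡ b ⟨mod n ⟩ → b ≡ c ⟨mod n ⟩ → a ≡ c ⟨mod n ⟩
  ≡⟨mod⟩-trans {a} {b} {c} a≡b b≡c =
    ∣-⇒≡⟨mod⟩ (subst (+ n Signed.∣_) (telescope a b c) (Signed.∣m∣n⇒∣m+n (≡⟨mod⟩⇒∣- a≡b) (≡⟨mod⟩⇒∣- b≡c)))
    where
    telescope : ∀ a b c → (a - b) + (b - c) ≡ a - c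
    telescope = solve-∀

  +-cong-mod : ∀ {a b c d} → a ≡ b ⟨mod n ⟩ → c ≡ d ⟨mod n ⟩ → a + c ≡ b + d ⟨mod n ⟩
  +-cong-mod {a} {b} {c} {d} a≡b c≡d = ∣-⇒≡⟨mod⟩ (subst (+ n Signed.∣_) (interchange a b c d)
    (Signed.∣m∣n⇒∣m+n (≡⟨mod⟩⇒∣- a≡b) (≡⟨mod⟩⇒∣- c≡d)))
    where
    interchange : ∀ a b c d → (a - b) + (c - d) ≡ (a + c) - (b + d)
    interchange = solve-∀

  ≡⟨mod⟩-refl : ∀ {a} → a ≡ a ⟨mod n ⟩
  ≡⟨mod⟩-refl = ≡⇒≡⟨mod⟩ refl

  *-cong-mod : ∀ {a b c d} → a ≡ b ⟨mod n ⟩ → c ≡ d ⟨mod n ⟩ → a * c ≡ b * d ⟨mod n ⟩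
  *-cong-mod {a} {b} {c} {d} a≡b c≡d = ∣-⇒≡⟨mod⟩ (subst (+ n Signed.∣_) (split a b c d)
    (Signed.∣m∣n⇒∣m+n (Signed.∣n⇒∣m*n a (≡⟨mod⟩⇒∣- c≡d)) (Signed.∣m⇒∣m*n d (≡⟨mod⟩⇒∣- a≡b))))
    where
    split : ∀ a b c d → a * (c - d) + (a - b) * d ≡ a * c - b * d
    split = solve-∀

  +-congˡ-mod : ∀ a {b c} → b ≡ c ⟨mod n ⟩ → a + b ≡ a + c ⟨mod n ⟩
  +-congˡ-mod a = +-cong-mod (≡⟨mod⟩-refl {a})

  *-congˡ-mod : ∀ a {b c} → b ≡ c ⟨mod n ⟩ → a * b ≡ a * c ⟨mod n ⟩
  *-congˡ-mod a = *-cong-mod (≡⟨mod⟩-refl {a})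

≡⟨mod⟩-setoid : ℕ → Setoid 0ℓ 0ℓ
≡⟨mod⟩-setoid n = record
  { Carrier       = ℤ
  ; _≈_           = _≡_⟨mod n ⟩
  ; isEquivalence = record { refl = ≡⟨mod⟩-refl ; sym = ≡⟨mod⟩-sym ; trans = ≡⟨mod⟩-trans }
  }

module ≡⟨mod⟩-Reasoning (n : ℕ) = SetoidReasoning (≡⟨mod⟩-setoid n)

rising-cong-mod : ∀ {q} n {x y} → x ≡ y ⟨mod q ⟩ → rising x n ≡ rising y n ⟨mod q ⟩
rising-cong-mod zero    x≡y = ≡⟨mod⟩-refl
rising-cong-mod {q} (suc n) {x} {y} x≡y = *-cong-mod 1+x≡1+y (rising-cong-mod n 1+x≡1+y)
  where
  1+x≡1+y : 1ℤ + x ≡ 1ℤ + y ⟨mod q ⟩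
  1+x≡1+y = +-congˡ-mod 1ℤ x≡y

module _ {q : ℕ} (f : ℤ → ℤ) where

  ∏-shift : ∀ T → (∀ X → f (X + + T) ≡ f X ⟨mod q ⟩) → ∀ X → ∏ f (1ℤ + X) T ≡ ∏ f X T ⟨mod q ⟩
  ∏-shift zero    f-periodic X = ≡⟨mod⟩-refl
  ∏-shift (suc T) f-periodic X = begin
    ∏ f (1ℤ + X) (suc T)                ≡⟨ ∏-suc f (1ℤ + X) T ⟩
    ∏ f (1ℤ + X) T * f ((1ℤ + X) + + T) ≡⟨ cong (λ B → ∏ f (1ℤ + X) T * f B) ([1+i]+j≡i+[1+j] X (+ T)) ⟩
    ∏ f (1ℤ + X) T * f (X + + suc T)    ≈⟨ *-congˡ-mod (∏ f (1ℤ + X) T) (f-periodic X) ⟩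
    ∏ f (1ℤ + X) T * f X                ≡⟨ ℤ.*-comm (∏ f (1ℤ + X) T) (f X) ⟩
    ∏ f X (suc T)                       ∎
    where open ≡⟨mod⟩-Reasoning q

  ∏-periodic : ∀ T → (∀ X → f (X + + T) ≡ f X ⟨mod q ⟩) → ∀ k X → ∏ f X (k ℕ.* T) ≡ ∏ f 0ℤ (k ℕ.* T) ⟨mod q ⟩
  ∏-periodic T f-periodic zero    X = ≡⟨mod⟩-refl
  ∏-periodic T f-periodic (suc k) X = begin
    ∏ f X (T ℕ.+ k ℕ.* T)               ≡⟨ ∏-+ f X T (k ℕ.* T) ⟩
    ∏ f X T * ∏ f (X + + T) (k ℕ.* T)   ≈⟨ *-cong-mod (one-period X) (∏-periodic T f-periodic k (X + + T)) ⟩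
    ∏ f 0ℤ T * ∏ f 0ℤ (k ℕ.* T)         ≈⟨ *-congˡ-mod (∏ f 0ℤ T) (∏-periodic T f-periodic k (0ℤ + + T)) ⟨
    ∏ f 0ℤ T * ∏ f (0ℤ + + T) (k ℕ.* T) ≡⟨ ∏-+ f 0ℤ T (k ℕ.* T) ⟨
    ∏ f 0ℤ (T ℕ.+ k ℕ.* T)              ∎
    where
    open ≡⟨mod⟩-Reasoning q
    one-period : ∀ X → ∏ f X T ≡ ∏ f 0ℤ T ⟨mod q ⟩
    one-period = ℤ-induction (λ X → ∏ f X T ≡ ∏ f 0ℤ T ⟨mod q ⟩) ≡⟨mod⟩-refl
      (λ X fX≡f0 → ≡⟨mod⟩-trans (∏-shift T f-periodic X) fX≡f0)
      (λ X fsX≡f0 → ≡⟨mod⟩-trans (≡⟨mod⟩-sym (∏-shift T f-periodic X)) fsX≡f0)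

-- blocks p A n = ∏_{i<n} (p(A+i)+1)(p(A+i)+2) ⋯ (p(A+i)+p-1): the factors of rising (p A) (n p) prime to p
blocks : ℕ → ℤ → ℕ → ℤ
blocks p = ∏ (λ X → rising (+ p * X) (p ∸ 1))

rising-split : ∀ {p} .{{_ : NonZero p}} n A → rising (+ p * A) (n ℕ.* p) ≡ + (p ^ n) * rising A n * blocks p A n
rising-split             zero    A = refl
rising-split {p@(suc p′)} (suc n) A = begin
  rising (P * A) (p ℕ.+ n ℕ.* p)                        ≡⟨ ∏-+ sucℤ (P * A) p (n ℕ.* p) ⟩
  rising (P * A) p * rising (P * A + P) (n ℕ.* p)       ≡⟨ cong₂ _*_ (∏-suc sucℤ (P * A) p′)
                                                             (cong (λ B → rising B (n ℕ.* p)) (p*A+p≡p*[1+A] A (+ p′))) ⟩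
  b * (1ℤ + (P * A + + p′)) * rising (P * A′) (n ℕ.* p) ≡⟨ cong₂ (λ x y → b * x * y)
                                                             (1+[p*A+p′]≡p*[1+A] A (+ p′)) (rising-split n A′) ⟩
  b * (P * A′) * (+ (p ^ n) * rising A′ n * blocks p A′ n)
                                                        ≡⟨ regroup b P A′ (+ (p ^ n)) (rising A′ n) (blocks p A′ n) ⟩
  P * + (p ^ n) * rising A (suc n) * blocks p A (suc n) ≡⟨ cong (λ x → x * rising A (suc n) * blocks p A (suc n))
                                                             (ℤ.pos-* p (p ^ n)) ⟨
  + (p ^ suc n) * rising A (suc n) * blocks p A (suc n) ∎
  where
  open ≡-Reasoning
  P  = + p
  A′ = 1ℤ + A
  b  = rising (P * A) p′
  p*A+p≡p*[1+A] : ∀ A q → (1ℤ + q) * A + (1ℤ + q) ≡ (1ℤ + q) * (1ℤ + A)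
  p*A+p≡p*[1+A] = solve-∀
  1+[p*A+p′]≡p*[1+A] : ∀ A q → 1ℤ + ((1ℤ + q) * A + q) ≡ (1ℤ + q) * (1ℤ + A)
  1+[p*A+p′]≡p*[1+A] = solve-∀
  regroup : ∀ b P c pn R B → b * (P * c) * (pn * R * B) ≡ P * pn * (c * R) * (b * B)
  regroup = solve-∀

[n*p]!≡p^n*n!*blocks : ∀ {p} .{{_ : NonZero p}} n → + ((n ℕ.* p) !) ≡ + (p ^ n) * + (n !) * blocks p 0ℤ n
[n*p]!≡p^n*n!*blocks {p} n = begin
  + ((n ℕ.* p) !)                         ≡⟨ rising-0 (n ℕ.* p) ⟨
  rising 0ℤ (n ℕ.* p)                     ≡⟨ cong (λ B → rising B (n ℕ.* p)) (ℤ.*-zeroʳ (+ p)) ⟨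
  rising (+ p * 0ℤ) (n ℕ.* p)             ≡⟨ rising-split n 0ℤ ⟩
  + (p ^ n) * rising 0ℤ n * blocks p 0ℤ n ≡⟨ cong (λ x → + (p ^ n) * x * blocks p 0ℤ n) (rising-0 n) ⟩
  + (p ^ n) * + (n !) * blocks p 0ℤ n     ∎
  where open ≡-Reasoning

binom[pM,Jp]*blocks≡binom[M,J]*blocks : ∀ {p} .{{_ : NonZero p}} M J →
  binom (+ p * M) (J ℕ.* p) * blocks p 0ℤ J ≡ binom M J * blocks p (M - + J) J
binom[pM,Jp]*blocks≡binom[M,J]*blocks {p} M J = ℤ.*-cancelʳ-≡ _ _ (+ (p ^ J ℕ.* J !)) {{p^J*J!≢0}} (begin
  b₁ * B₀ * + (p ^ J ℕ.* J !)              ≡⟨ cong (b₁ * B₀ *_) (ℤ.pos-* (p ^ J) (J !)) ⟩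
  b₁ * B₀ * (pᴶ * J!)                      ≡⟨ rotate b₁ B₀ pᴶ J! ⟩
  b₁ * (pᴶ * J! * B₀)                      ≡⟨ cong (b₁ *_) ([n*p]!≡p^n*n!*blocks J) ⟨
  b₁ * + ((J ℕ.* p) !)                     ≡⟨ binom*!≡rising (+ p * M) (J ℕ.* p) ⟩
  rising (+ p * M - + (J ℕ.* p)) (J ℕ.* p) ≡⟨ cong (λ B → rising B (J ℕ.* p)) (p*M-J*p≡p*[M-J]) ⟩
  rising (+ p * (M - + J)) (J ℕ.* p)       ≡⟨ rising-split J (M - + J) ⟩
  pᴶ * rising (M - + J) J * Bₓ             ≡⟨ cong (λ x → pᴶ * x * Bₓ) (binom*!≡rising M J) ⟨
  pᴶ * (b₂ * J!) * Bₓ                      ≡⟨ rearrange pᴶ b₂ J! Bₓ ⟩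
  b₂ * Bₓ * (pᴶ * J!)                      ≡⟨ cong (b₂ * Bₓ *_) (ℤ.pos-* (p ^ J) (J !)) ⟨
  b₂ * Bₓ * + (p ^ J ℕ.* J !)              ∎)
  where
  open ≡-Reasoning
  b₁ = binom (+ p * M) (J ℕ.* p)
  b₂ = binom M J
  B₀ = blocks p 0ℤ J
  Bₓ = blocks p (M - + J) J
  pᴶ = + (p ^ J)
  J! = + (J !)
  p^J*J!≢0 : NonZero (p ^ J ℕ.* J !)
  p^J*J!≢0 = ℕ.m*n≢0 (p ^ J) (J !) {{ℕ.m^n≢0 p J}} {{J !≢0}}
  rotate : ∀ b B x y → b * B * (x * y) ≡ b * (x * y * B)
  rotate = solve-∀
  rearrange : ∀ x b y B → x * (b * y) * B ≡ b * B * (x * y)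
  rearrange = solve-∀
  p*M-J*p≡p*[M-J] : + p * M - + (J ℕ.* p) ≡ + p * (M - + J)
  p*M-J*p≡p*[M-J] = trans (cong (λ x → + p * M - x) (ℤ.pos-* J p)) (factor (+ p) M (+ J))
    where
    factor : ∀ P M J → P * M - J * P ≡ P * (M - J)
    factor = solve-∀

blocks-periodic : ∀ {p} t k X → blocks p X (k ℕ.* p ^ t) ≡ blocks p 0ℤ (k ℕ.* p ^ t) ⟨mod p ^ suc t ⟩
blocks-periodic {p} t = ∏-periodic (λ X → rising (+ p * X) (p ∸ 1)) (p ^ t)
  (λ X → rising-cong-mod (p ∸ 1) (p*[X+T]≡p*X X))
  where
  p*[X+T]≡p*X : ∀ X → + p * (X + + (p ^ t)) ≡ + p * X ⟨mod p ^ suc t ⟩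
  p*[X+T]≡p*X X = ⟨ ℕ.∣-reflexive (sym (trans (cong ∣_∣ (difference (+ p) X (+ (p ^ t)))) (ℤ.abs-* (+ p) (+ (p ^ t))))) ⟩
    where
    difference : ∀ P X T → P * (X + T) - P * X ≡ P * T
    difference = solve-∀

p∤p*X+r : ∀ {p r} X → 0 ℕ.< r → r ℕ.< p → p ∤ ∣ + p * X + + r ∣
p∤p*X+r {p} {r} X 0<r r<p p∣p*X+r = ℕ.>⇒∤ {{ℕ.>-nonZero 0<r}} r<p (Signed.∣⇒∣ᵤ p∣r)
  where
  p∣r : + p Signed.∣ + r
  p∣r = Signed.∣m+n∣m⇒∣n (Signed.∣ᵤ⇒∣ p∣p*X+r) (Signed.∣m⇒∣m*n X Signed.∣-refl)

module _ {p : ℕ} (p-prime : Prime p) where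

  instance
    p-nonZero : NonZero p
    p-nonZero = prime⇒nonZero p-prime

  p∤1 : p ∤ 1
  p∤1 p∣1 = ℕ.nonTrivial⇒≢1 {{prime⇒nonTrivial p-prime}} (ℕ.∣1⇒≡1 p∣1)

  p∤* : ∀ x y → p ∤ ∣ x ∣ → p ∤ ∣ y ∣ → p ∤ ∣ x * y ∣
  p∤* x y p∤x p∤y p∣xy with euclidsLemma ∣ x ∣ ∣ y ∣ p-prime (subst (p ℕ.∣_) (ℤ.abs-* x y) p∣xy)
  ... | inj₁ p∣x = p∤x p∣x
  ... | inj₂ p∣y = p∤y p∣y

  p∤∏ : ∀ f A n → (∀ i → i ℕ.< n → p ∤ ∣ f (A + + i) ∣) → p ∤ ∣ ∏ f A n ∣
  p∤∏ f A zero    p∤f = p∤1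
  p∤∏ f A (suc n) p∤f = subst (λ x → p ∤ ∣ x ∣) (sym (∏-suc f A n))
    (p∤* (∏ f A n) (f (A + + n)) (p∤∏ f A n (λ i i<n → p∤f i (ℕ.m<n⇒m<1+n i<n))) (p∤f n ℕ.≤-refl))

  p^e∣m*n⇒p^e∣m : ∀ e {m n} → p ∤ n → p ^ e ℕ.∣ m ℕ.* n → p ^ e ℕ.∣ m
  p^e∣m*n⇒p^e∣m zero    _ _ = ℕ.1∣ _
  p^e∣m*n⇒p^e∣m (suc e) {m} {n} p∤n p^[1+e]∣mn
    with euclidsLemma m n p-prime (ℕ.∣-trans (ℕ.m∣m*n (p ^ e)) p^[1+e]∣mn)
  ... | inj₂ p∣n = contradiction p∣n p∤n
  ... | inj₁ (ℕ.divides m′ refl) = subst (p ^ suc e ℕ.∣_) (ℕ.*-comm p m′) (ℕ.*-monoʳ-∣ p p^e∣m′)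
    where
    p^e∣m′ : p ^ e ℕ.∣ m′
    p^e∣m′ = p^e∣m*n⇒p^e∣m e p∤n (ℕ.*-cancelˡ-∣ p
               (subst (p ^ suc e ℕ.∣_) (trans (cong (ℕ._* n) (ℕ.*-comm m′ p)) (ℕ.*-assoc p m′ n)) p^[1+e]∣mn))

  *-cancelʳ-mod : ∀ e {a b u} → p ∤ ∣ u ∣ → a * u ≡ b * u ⟨mod p ^ e ⟩ → a ≡ b ⟨mod p ^ e ⟩
  *-cancelʳ-mod e {a} {b} {u} p∤u ⟨ p^e∣au-bu ⟩ = ⟨ p^e∣m*n⇒p^e∣m e p∤u
    (subst (p ^ e ℕ.∣_) (trans (cong ∣_∣ (sub-distrib a b u)) (ℤ.abs-* (a - b) u)) p^e∣au-bu) ⟩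
    where
    sub-distrib : ∀ a b u → a * u - b * u ≡ (a - b) * u
    sub-distrib = solve-∀

  p∤blocks : ∀ X n → p ∤ ∣ blocks p X n ∣
  p∤blocks X n = p∤∏ _ X n (λ i _ → p∤block (X + + i))
    where
    p∤block : ∀ Y → p ∤ ∣ rising (+ p * Y) (p ∸ 1) ∣
    p∤block Y = p∤∏ sucℤ (+ p * Y) (p ∸ 1) λ i i<p-1 →
      subst (λ x → p ∤ ∣ x ∣) (sym (1+[X+i]≡X+[1+i] (+ p * Y) (+ i))) (p∤p*X+r Y (s≤s z≤n) (ℕ.pred-cancel-< i<p-1))
      where
      1+[X+i]≡X+[1+i] : ∀ X i → 1ℤ + (X + i) ≡ X + (1ℤ + i)
      1+[X+i]≡X+[1+i] = solve-∀

  binom[1+N]≡binom[N] : ∀ e N j → p ∤ ∣ 1ℤ + N ∣ → p ^ e ℕ.∣ j → binom (1ℤ + N) j ≡ binom N j ⟨mod p ^ e ⟩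
  binom[1+N]≡binom[N] e N zero    _     _       = ≡⟨mod⟩-refl
  binom[1+N]≡binom[N] e N (suc j) p∤1+N p^e∣1+j = begin
    binom (1ℤ + N) (suc j)      ≡⟨ binom-pascal N j ⟩
    binom N (suc j) + binom N j ≈⟨ +-congˡ-mod (binom N (suc j)) binom≡0 ⟩
    binom N (suc j) + 0ℤ        ≡⟨ ℤ.+-identityʳ (binom N (suc j)) ⟩
    binom N (suc j)             ∎
    where
    open ≡⟨mod⟩-Reasoning (p ^ e)
    1+j≡0 : + suc j ≡ 0ℤ ⟨mod p ^ e ⟩
    1+j≡0 = ⟨ subst (p ^ e ℕ.∣_) (sym (ℕ.+-identityʳ (suc j))) p^e∣1+j ⟩
    binom≡0 : binom N j ≡ 0ℤ ⟨mod p ^ e ⟩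
    binom≡0 = *-cancelʳ-mod e p∤1+N (begin
      binom N j * (1ℤ + N)             ≡⟨ ℤ.*-comm (binom N j) (1ℤ + N) ⟩
      (1ℤ + N) * binom N j             ≡⟨ binom-absorption N j ⟩
      + suc j * binom (1ℤ + N) (suc j) ≈⟨ *-cong-mod 1+j≡0 (≡⟨mod⟩-refl {a = binom (1ℤ + N) (suc j)}) ⟩
      0ℤ * (1ℤ + N)                    ∎)

  binom[pM+r]≡binom[pM] : ∀ e M {r} j → r ℕ.< p → p ^ e ℕ.∣ j → binom (+ p * M + + r) j ≡ binom (+ p * M) j ⟨mod p ^ e ⟩
  binom[pM+r]≡binom[pM] e M {zero}  j _   _     = ≡⇒≡⟨mod⟩ (cong (λ B → binom B j) (ℤ.+-identityʳ (+ p * M)))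
  binom[pM+r]≡binom[pM] e M {suc r} j r<p p^e∣j = begin
    binom (+ p * M + + suc r) j ≡⟨ cong (λ B → binom B j) (X+[1+r]≡1+[X+r] (+ p * M) (+ r)) ⟩
    binom (1ℤ + N) j            ≈⟨ binom[1+N]≡binom[N] e N j p∤1+N p^e∣j ⟩
    binom N j                   ≈⟨ binom[pM+r]≡binom[pM] e M j (ℕ.<-trans (ℕ.n<1+n r) r<p) p^e∣j ⟩
    binom (+ p * M) j           ∎
    where
    open ≡⟨mod⟩-Reasoning (p ^ e)
    N = + p * M + + r
    X+[1+r]≡1+[X+r] : ∀ X r → X + (1ℤ + r) ≡ 1ℤ + (X + r)
    X+[1+r]≡1+[X+r] = solve-∀
    p∤1+N : p ∤ ∣ 1ℤ + N ∣
    p∤1+N = subst (λ x → p ∤ ∣ x ∣) (X+[1+r]≡1+[X+r] (+ p * M) (+ r)) (p∤p*X+r M (s≤s z≤n) r<p)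

  binom[pM,Jp]≡binom[M,J] : ∀ t M J → p ^ t ℕ.∣ J → binom (+ p * M) (J ℕ.* p) ≡ binom M J ⟨mod p ^ suc t ⟩
  binom[pM,Jp]≡binom[M,J] t M _ (ℕ.divides k refl) = *-cancelʳ-mod (suc t) (p∤blocks 0ℤ J) (begin
    binom (+ p * M) (J ℕ.* p) * blocks p 0ℤ J ≡⟨ binom[pM,Jp]*blocks≡binom[M,J]*blocks M J ⟩
    binom M J * blocks p (M - + J) J          ≈⟨ *-congˡ-mod (binom M J) (blocks-periodic t k (M - + J)) ⟩
    binom M J * blocks p 0ℤ J                 ∎)
    where
    open ≡⟨mod⟩-Reasoning (p ^ suc t)
    J = k ℕ.* p ^ t

ceilDiv-overshoot : ∀ ℓ d .{{_ : NonZero d}} → ∃[ r ] r ℕ.< d × ℓ ℕ.+ r ≡ ceilDiv ℓ d ℕ.* d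
ceilDiv-overshoot ℓ d@(suc d′) = d′ ∸ rem , s≤s (ℕ.m∸n≤m d′ rem) , ℕ.+-cancelʳ-≡ rem _ _ (begin
  ℓ ℕ.+ (d′ ∸ rem) ℕ.+ rem  ≡⟨ ℕ.+-assoc ℓ (d′ ∸ rem) rem ⟩
  ℓ ℕ.+ (d′ ∸ rem ℕ.+ rem)  ≡⟨ cong (ℓ ℕ.+_) (ℕ.m∸n+n≡m rem≤d′) ⟩
  ℓ ℕ.+ d′                  ≡⟨ ℕ.m≡m%n+[m/n]*n (ℓ ℕ.+ d′) d ⟩
  rem ℕ.+ ceilDiv ℓ d ℕ.* d ≡⟨ ℕ.+-comm rem _ ⟩
  ceilDiv ℓ d ℕ.* d ℕ.+ rem ∎)
  where
  open ≡-Reasoning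
  rem = (ℓ ℕ.+ d′) ℕ.% d
  rem≤d′ : rem ℕ.≤ d′
  rem≤d′ = ℕ.≤-pred (ℕ.m%n<n (ℓ ℕ.+ d′) d)

m*[P*T]-l≡P*[m*T-c]+r : ∀ P m T l r c → l + r ≡ c * P → m * (P * T) - l ≡ P * (m * T - c) + r
m*[P*T]-l≡P*[m*T-c]+r P m T l r c l+r≡c*P = begin
  m * (P * T) - l           ≡⟨ add-sub m P T l r ⟩
  m * (P * T) - (l + r) + r ≡⟨ cong (λ x → m * (P * T) - x + r) l+r≡c*P ⟩
  m * (P * T) - c * P + r   ≡⟨ factor P m T c r ⟩
  P * (m * T - c) + r       ∎
  where
  open ≡-Reasoning
  add-sub : ∀ m P T l r → m * (P * T) - l ≡ m * (P * T) - (l + r) + r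
  add-sub = solve-∀
  factor : ∀ P m T c r → m * (P * T) - c * P + r ≡ P * (m * T - c) + r
  factor = solve-∀

lemma2p6 : (p : ℕ) → (pp : Prime p) → (m : ℤ) → (k ℓ s : ℕ) → s ≥ 1 →
    binom (m * + (p ^ s) - + ℓ) (k Data.Nat.* p ^ s)
      ≡ binom (m * + (p ^ (s Data.Nat.∸ 1)) - + ceilDiv ℓ p {{prime⇒nonZero pp}}) (k Data.Nat.* p ^ (s Data.Nat.∸ 1))
      [mod p ^ s ]
lemma2p6 p pp m k ℓ (suc t) _ with ceilDiv-overshoot ℓ p {{prime⇒nonZero pp}}
... | r , r<p , ℓ+r≡c*p = ≡-mod (begin
  binom (m * + (p ^ suc t) - + ℓ) (k ℕ.* p ^ suc t) ≡⟨ cong (λ N → binom N (k ℕ.* p ^ suc t)) decomposition ⟩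
  binom (+ p * M + + r) (k ℕ.* p ^ suc t)           ≈⟨ binom[pM+r]≡binom[pM] pp (suc t) M (k ℕ.* p ^ suc t) r<p (ℕ.n∣m*n k) ⟩
  binom (+ p * M) (k ℕ.* p ^ suc t)                 ≡⟨ cong (binom (+ p * M)) (k*[p*T]≡[k*T]*p k p (p ^ t)) ⟩
  binom (+ p * M) (k ℕ.* p ^ t ℕ.* p)               ≈⟨ binom[pM,Jp]≡binom[M,J] pp t M (k ℕ.* p ^ t) (ℕ.n∣m*n k) ⟩
  binom M (k ℕ.* p ^ t)                             ∎)
  where
  open ≡⟨mod⟩-Reasoning (p ^ suc t)
  c = ceilDiv ℓ p {{prime⇒nonZero pp}}
  M = m * + (p ^ t) - + c
  k*[p*T]≡[k*T]*p : ∀ k p T → k ℕ.* (p ℕ.* T) ≡ k ℕ.* T ℕ.* p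
  k*[p*T]≡[k*T]*p = ℕ-Solver.solve-∀
  decomposition : m * + (p ^ suc t) - + ℓ ≡ + p * M + + r
  decomposition = trans (cong (λ x → m * x - + ℓ) (ℤ.pos-* p (p ^ t)))
    (m*[P*T]-l≡P*[m*T-c]+r (+ p) m (+ (p ^ t)) (+ ℓ) (+ r) (+ c) (trans (cong +_ ℓ+r≡c*p) (ℤ.pos-* c p)))
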